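{- Let $p$ be a prime and let $f:\mathbb{N}_0\to\mathbb{Z}_p$ satisfy $\Delta^n f(0)\equiv0\pmod{p^n\mathbb{Z}_p}$ for all $n\ge0$. Then $f$ extends uniquely to a continuous function $\mathbb{Z}_p\to\mathbb{Z}_p$, and this extension lies in $\mathcal{K}_{p,2}$.
   Context: $\Delta^n f(s)=\sum_{\nu=0}^n\binom{n}{\nu}(-1)^{n-\nu}f(s+\nu)$. $\mathcal{K}_{p,2}$ is the set of $f:\mathbb{Z}_p\to\mathbb{Z}_p$ with $\Delta^n f(s)\equiv0\pmod{p^n\mathbb{Z}_p}$ for all $s\in\mathbb{Z}_p$ and all $n\ge0$. -}

module Defs where

open import Data.Nat as ℕ using (ℕ; zero; suc; _∸_)
open import Data.Nat.Combinatorics using (_C_)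
open import Data.Integer as ℤ using (ℤ; +_; _+_; _-_; _*_; -_; 0ℤ; 1ℤ)
open import Data.Integer.Divisibility.Signed using (_∣_; ∣m∣n⇒∣m+n; ∣n⇒∣m*n; ∣-refl)
open import Data.Integer.Tactic.RingSolver using (solve-∀)
open import Data.Product using (Σ; ∃; _×_; _,_)
open import Relation.Binary.PropositionalEquality using (_≡_; refl; subst; sym)

-- The p-adic integers ℤ_p, realised as the completion of ℤ:
-- a coherent sequence of integer approximations, where approx k is
-- x modulo p^k (the sequence is coherent: approx (k+1) ≡ approx k mod p^k).
record ℤₚ (p : ℕ) : Set where
  constructor mkℤₚ
  field
    approx : ℕ → ℤ
    coh    : ∀ k → (+ (p ℕ.^ k)) ∣ (approx (suc k) - approx k)
open ℤₚ public

module _ {p : ℕ} where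

  _≡_[modp^_] : ℤₚ p → ℤₚ p → ℕ → Set
  x ≡ y [modp^ k ] = (+ (p ℕ.^ k)) ∣ (approx x k - approx y k)

  _≈ₚ_ : ℤₚ p → ℤₚ p → Set
  x ≈ₚ y = ∀ k → x ≡ y [modp^ k ]

  _∈p^_ℤₚ : ℤₚ p → ℕ → Set
  x ∈p^ n ℤₚ = (+ (p ℕ.^ n)) ∣ approx x n

  ιℤ : ℤ → ℤₚ p
  ιℤ a = mkℤₚ (λ _ → a) (λ k → subst ((+ (p ℕ.^ k)) ∣_) (sym (lem a)) (∣n⇒∣m*n 0ℤ ∣-refl))
    where
    lem : ∀ a → a - a ≡ 0ℤ * (+ (p ℕ.^ 0))
    lem = solve-∀

  ι : ℕ → ℤₚ p
  ι n = ιℤ (+ n)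

  infixl 6 _+ₚ_
  _+ₚ_ : ℤₚ p → ℤₚ p → ℤₚ p
  x +ₚ y = mkℤₚ (λ k → approx x k + approx y k)
    (λ k → subst ((+ (p ℕ.^ k)) ∣_)
       (lem (approx x (suc k)) (approx x k) (approx y (suc k)) (approx y k))
       (∣m∣n⇒∣m+n (coh x k) (coh y k)))
    where
    lem : ∀ a a' b b' → (a - a') + (b - b') ≡ (a + b) - (a' + b')
    lem = solve-∀

  infixl 7 _·ₚ_
  _·ₚ_ : ℤ → ℤₚ p → ℤₚ p
  c ·ₚ x = mkℤₚ (λ k → c * approx x k)
    (λ k → subst ((+ (p ℕ.^ k)) ∣_) (lem c (approx x (suc k)) (approx x k))
       (∣n⇒∣m*n c (coh x k)))
    where
    lem : ∀ c a a' → c * (a - a') ≡ c * a - c * a'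
    lem = solve-∀

  sumBelow : (ℕ → ℤₚ p) → ℕ → ℤₚ p
  sumBelow h zero    = ι 0
  sumBelow h (suc m) = sumBelow h m +ₚ h m

  finDiff : (ℕ → ℤₚ p) → ℕ → ℤₚ p
  finDiff g n = sumBelow (λ ν → ((+ (n C ν)) * ((- 1ℤ) ℤ.^ (n ∸ ν))) ·ₚ g ν) (suc n)

  Δ^_[_]_ : ℕ → (ℤₚ p → ℤₚ p) → ℤₚ p → ℤₚ p
  Δ^ n [ f ] s = finDiff (λ ν → f (s +ₚ ι ν)) n

  𝒦₂ : (ℤₚ p → ℤₚ p) → Set
  𝒦₂ f = ∀ (s : ℤₚ p) (n : ℕ) → (Δ^ n [ f ] s) ∈p^ n ℤₚ

  Continuous : (ℤₚ p → ℤₚ p) → Set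
  Continuous F = ∀ (x : ℤₚ p) (k : ℕ) → ∃ λ m →
    ∀ (y : ℤₚ p) → x ≡ y [modp^ m ] → F x ≡ F y [modp^ k ]

  Extends : (ℤₚ p → ℤₚ p) → (ℕ → ℤₚ p) → Set
  Extends F f = ∀ (n : ℕ) → F (ι n) ≈ₚ f n

module Submission where

-- Write g_K(ν) ∈ ℤ for the level-K approximation of f(ν) and e(K) = K(K-1)/2.
-- The hypothesis p^n ∣ Δⁿf(0) yields, for every K, the bound
-- p^min(n,K) ∣ Δⁿg_K(N) for all n and N.  The central periodicity lemma says that
-- any integer sequence g with this bound satisfies g(a + t·p^e(K)) ≡ g(a) (mod p^K):
-- by induction on K, Δg = p·g' where g' has the bound at level K-1, so the
-- increments g(b + p^e(K-1)) - g(b) are constant modulo p^K, hence grow linearly,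
-- and p^(K-1) further periods kill them.  Consequently g_K(N) mod p^K only depends
-- on N mod p^e(K), and F(x) := (g_K(x mod p^e(K)))_K is a well-defined p-adic
-- integer, continuous, extending f, and unique by density of ℕ₀.  Finally Δⁿ F(s)
-- at level n equals Δⁿ g_n at a natural number congruent to s, so F ∈ 𝒦_{p,2}.

open import Defs
open import Data.Nat using (ℕ)
open import Data.Nat.Primality using (Prime)
open import Data.Product using (Σ; _×_)

open import Data.Nat as ℕ using (zero; suc; _∸_; _⊓_; _≤_; NonZero)
import Data.Nat.Properties as ℕP
import Data.Nat.Divisibility as ℕD
import Data.Nat.Tactic.RingSolver as ℕSolver
open import Data.Nat.Primality using (prime⇒nonZero)
open import Data.Nat.Combinatorics using (_C_; k>n⇒nCk≡0; nCk+nC[k+1]≡[n+1]C[k+1])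
open import Data.Integer as ℤ using (ℤ; +_; _+_; _-_; _*_; -_; 0ℤ; 1ℤ)
import Data.Integer.Properties as ℤP
open import Data.Integer.Divisibility.Signed using (_∣_; divides; ∣-trans; ∣m∣n⇒∣m+n; ∣m⇒∣-m; ∣n⇒∣m*n; *-monoʳ-∣; *-monoˡ-∣; *-cancelʳ-∣; ∣ᵤ⇒∣; ∣⇒∣ᵤ)
open import Data.Integer.DivMod using (_%ℕ_; _/ℕ_; a≡a%ℕn+[a/ℕn]*n)
open import Data.Integer.Tactic.RingSolver using (solve-∀)
open import Data.Product using (_,_; proj₁; proj₂)
open import Data.Sum using (inj₁; inj₂)
open import Relation.Binary.Bundles using (Setoid)
import Relation.Binary.Reasoning.Setoid as SetoidReasoning
open import Relation.Binary.PropositionalEquality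

-- It is wrapped in a
-- record so that a, b and m can be inferred; Defs states its congruences on
-- approximations as the bare divisibility, recovered by `difference`.
infix 4 _≡_[mod_]
record _≡_[mod_] (a b : ℤ) (m : ℕ) : Set where
  constructor mod
  field difference : + m ∣ a - b
open _≡_[mod_] public

module _ {m : ℕ} where

  mod-reflexive : ∀ {a b} → a ≡ b → a ≡ b [mod m ]
  mod-reflexive {a} refl = mod (subst (+ m ∣_) (sym (ℤP.+-inverseʳ a)) (divides 0ℤ refl))

  mod-sym : ∀ {a b} → a ≡ b [mod m ] → b ≡ a [mod m ]
  mod-sym {a} {b} (mod d) = mod (subst (+ m ∣_) (negate a b) (∣m⇒∣-m d))
    where
    negate : ∀ a b → - (a - b) ≡ b - a
    negate = solve-∀

  mod-trans : ∀ {a b c} → a ≡ b [mod m ] → b ≡ c [mod m ] → a ≡ c [mod m ]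
  mod-trans {a} {b} {c} (mod d) (mod e) = mod (subst (+ m ∣_) (ℤP.+-minus-telescope a b c) (∣m∣n⇒∣m+n d e))

  mod-sub : ∀ {a b c d} → a ≡ b [mod m ] → c ≡ d [mod m ] → a - c ≡ b - d [mod m ]
  mod-sub {a} {b} {c} {d} (mod ab) (mod cd) = mod (subst (+ m ∣_) (regroup a b c d) (∣m∣n⇒∣m+n ab (∣m⇒∣-m cd)))
    where
    regroup : ∀ a b c d → (a - b) + - (c - d) ≡ (a - c) - (b - d)
    regroup = solve-∀

  mod-+ʳ : ∀ {a b} c → a ≡ b [mod m ] → a + c ≡ b + c [mod m ]
  mod-+ʳ {a} {b} c (mod d) = mod (subst (+ m ∣_) (cancel a b c) d)
    where
    cancel : ∀ a b c → a - b ≡ (a + c) - (b + c)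
    cancel = solve-∀

  mod-∣ : ∀ {a b} → a ≡ b [mod m ] → + m ∣ b → + m ∣ a
  mod-∣ {a} {b} (mod ab) m∣b = subst (+ m ∣_) (cancel a b) (∣m∣n⇒∣m+n ab m∣b)
    where
    cancel : ∀ a b → (a - b) + b ≡ a
    cancel = solve-∀

%ℕ-≡ : ∀ z n .{{_ : NonZero n}} → z ≡ + (z %ℕ n) [mod n ]
%ℕ-≡ z n = mod (divides (z /ℕ n)
  (trans (cong (_- + (z %ℕ n)) (a≡a%ℕn+[a/ℕn]*n z n)) (cancel (+ (z %ℕ n)) ((z /ℕ n) * + n))))
  where
  cancel : ∀ r s → (r + s) - r ≡ s
  cancel = solve-∀

mod-setoid : ℕ → Setoid _ _
mod-setoid m = record
  { Carrier       = ℤ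
  ; _≈_           = _≡_[mod m ]
  ; isEquivalence = record { refl = mod-reflexive refl ; sym = mod-sym ; trans = mod-trans }
  }

module ModReasoning (m : ℕ) = SetoidReasoning (mod-setoid m)

mod-weaken : ∀ {d m a b} → d ℕD.∣ m → a ≡ b [mod m ] → a ≡ b [mod d ]
mod-weaken d∣m (mod d) = mod (∣-trans (∣ᵤ⇒∣ d∣m) d)

telescope : ∀ {m} (h : ℕ → ℤ) → (∀ x → h (suc x) ≡ h x [mod m ]) → ∀ x → h x ≡ h 0 [mod m ]
telescope h step zero    = mod-reflexive refl
telescope h step (suc x) = mod-trans (step x) (telescope h step x)

arith-progression : ∀ {m} (g : ℕ → ℤ) Q c → (∀ b → g (b ℕ.+ Q) - g b ≡ c [mod m ]) →
  ∀ a u → g (a ℕ.+ u ℕ.* Q) - g a ≡ + u * c [mod m ]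
arith-progression g Q c step a zero =
  mod-reflexive (trans (cong (λ i → g i - g a) (ℕP.+-identityʳ a)) (ℤP.+-inverseʳ (g a)))
arith-progression {m} g Q c step a (suc u) = subst (λ i → g i - g a ≡ + suc u * c [mod m ]) (sym index)
  (mod (subst (+ m ∣_) (regroup (g (b ℕ.+ Q)) (g b) (g a) c (+ u))
    (∣m∣n⇒∣m+n (difference (step b)) (difference (arith-progression g Q c step a u)))))
  where
  b = a ℕ.+ u ℕ.* Q
  index : a ℕ.+ suc u ℕ.* Q ≡ b ℕ.+ Q
  index = reorder a u Q
    where
    reorder : ∀ a u Q → a ℕ.+ (Q ℕ.+ u ℕ.* Q) ≡ (a ℕ.+ u ℕ.* Q) ℕ.+ Q
    reorder = ℕSolver.solve-∀
  regroup : ∀ x y z c u → ((x - y) - c) + ((y - z) - u * c) ≡ (x - z) - (+ 1 + u) * c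
  regroup = solve-∀

Δ : (ℕ → ℤ) → ℕ → ℤ
Δ h x = h (suc x) - h x

D : ℕ → (ℕ → ℤ) → ℕ → ℤ
D zero    h = h
D (suc n) h = D n (Δ h)

D-cong : ∀ n {h h' : ℕ → ℤ} → (∀ x → h x ≡ h' x) → ∀ N → D n h N ≡ D n h' N
D-cong zero    eq N = eq N
D-cong (suc n) eq N = D-cong n (λ x → cong₂ _-_ (eq (suc x)) (eq x)) N

D-sub : ∀ n (h₁ h₂ : ℕ → ℤ) N → D n (λ x → h₁ x - h₂ x) N ≡ D n h₁ N - D n h₂ N
D-sub zero    h₁ h₂ N = refl
D-sub (suc n) h₁ h₂ N =
  trans (D-cong n (λ x → interchange (h₁ (suc x)) (h₂ (suc x)) (h₁ x) (h₂ x)) N)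
        (D-sub n (Δ h₁) (Δ h₂) N)
  where
  interchange : ∀ a b c d → (a - b) - (c - d) ≡ (a - c) - (b - d)
  interchange = solve-∀

D-scale : ∀ n (h : ℕ → ℤ) k N → D n (λ x → h x * k) N ≡ D n h N * k
D-scale zero    h k N = refl
D-scale (suc n) h k N = trans (D-cong n (λ x → factor (h (suc x)) (h x) k) N) (D-scale n (Δ h) k N)
  where
  factor : ∀ a b k → a * k - b * k ≡ (a - b) * k
  factor = solve-∀

D-mod : ∀ {m} n {h h' : ℕ → ℤ} → (∀ x → h x ≡ h' x [mod m ]) → ∀ N → D n h N ≡ D n h' N [mod m ]
D-mod zero    eq N = eq N
D-mod (suc n) eq N = D-mod n (λ x → mod-sub (eq (suc x)) (eq x)) N

D-shift : ∀ n (h : ℕ → ℤ) N → D n (λ x → h (suc x)) N ≡ D n h (suc N)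
D-shift zero    h N = refl
D-shift (suc n) h N = D-shift n (Δ h) N

D-translate : ∀ n (h : ℕ → ℤ) N → D n (λ x → h (N ℕ.+ x)) 0 ≡ D n h N
D-translate n h zero    = refl
D-translate n h (suc N) = trans (D-translate n (λ x → h (suc x)) N) (D-shift n h N)

D-step : ∀ n (h : ℕ → ℤ) N → D (suc n) h N ≡ D n h (suc N) - D n h N
D-step n h N = trans (D-sub n (λ x → h (suc x)) h N) (cong (_- D n h N) (D-shift n h N))

-- ∑ u m = Σ_{ν<m} u(ν), built up in the same order as sumBelow of Defs.
∑ : (ℕ → ℤ) → ℕ → ℤ
∑ u zero    = 0ℤ
∑ u (suc m) = ∑ u m + u m

∑-cong : ∀ {u v : ℕ → ℤ} → (∀ ν → u ν ≡ v ν) → ∀ m → ∑ u m ≡ ∑ v m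
∑-cong eq zero    = refl
∑-cong eq (suc m) = cong₂ _+_ (∑-cong eq m) (eq m)

∑-sub : ∀ (u v : ℕ → ℤ) m → ∑ (λ ν → u ν - v ν) m ≡ ∑ u m - ∑ v m
∑-sub u v zero    = refl
∑-sub u v (suc m) = trans (cong (_+ (u m - v m)) (∑-sub u v m)) (interchange (∑ u m) (∑ v m) (u m) (v m))
  where
  interchange : ∀ a b c d → (a - b) + (c - d) ≡ (a + c) - (b + d)
  interchange = solve-∀

∑-head : ∀ (u : ℕ → ℤ) m → ∑ u (suc m) ≡ u 0 + ∑ (λ ν → u (suc ν)) m
∑-head u zero    = ℤP.+-comm 0ℤ (u 0)
∑-head u (suc m) = trans (cong (_+ u (suc m)) (∑-head u m)) (ℤP.+-assoc (u 0) _ (u (suc m)))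

binom : ℕ → ℕ → ℤ
binom n ν = + (n C ν) * (- 1ℤ) ℤ.^ (n ∸ ν)

binom-top : ∀ n → binom n (suc n) ≡ 0ℤ
binom-top n = cong (λ c → + c * (- 1ℤ) ℤ.^ (n ∸ suc n)) (k>n⇒nCk≡0 (ℕP.n<1+n n))

binom-bottom : ∀ n → binom (suc n) 0 ≡ - binom n 0
binom-bottom n = negate ((- 1ℤ) ℤ.^ n)
  where
  negate : ∀ s → + 1 * (- 1ℤ * s) ≡ - (+ 1 * s)
  negate = solve-∀

-- C(n,k+1)(-1)^(n-k) = -C(n,k+1)(-1)^(n-k-1); both sides vanish when k ≥ n.
sign-shift : ∀ a n k → (n ≤ k → a ≡ 0) →
  + a * (- 1ℤ) ℤ.^ (n ∸ k) ≡ - (+ a * (- 1ℤ) ℤ.^ (n ∸ suc k))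
sign-shift a zero    k       vanish rewrite vanish ℕ.z≤n = refl
sign-shift a (suc n) zero    vanish = negate (+ a) ((- 1ℤ) ℤ.^ n)
  where
  negate : ∀ x s → x * (- 1ℤ * s) ≡ - (x * s)
  negate = solve-∀
sign-shift a (suc n) (suc k) vanish = sign-shift a n k (λ n≤k → vanish (ℕ.s≤s n≤k))

binom-pascal : ∀ n ν → binom (suc n) (suc ν) ≡ binom n ν - binom n (suc ν)
binom-pascal n ν = begin
    + (suc n C suc ν) * s
  ≡⟨ cong (λ c → + c * s) (sym (nCk+nC[k+1]≡[n+1]C[k+1] n ν)) ⟩
    (+ (n C ν) + + (n C suc ν)) * s
  ≡⟨ ℤP.*-distribʳ-+ s (+ (n C ν)) (+ (n C suc ν)) ⟩
    + (n C ν) * s + + (n C suc ν) * s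
  ≡⟨ cong (λ z → binom n ν + z) (sign-shift (n C suc ν) n ν (λ n≤ν → k>n⇒nCk≡0 (ℕ.s≤s n≤ν))) ⟩
    binom n ν - binom n (suc ν) ∎
  where
  open ≡-Reasoning
  s = (- 1ℤ) ℤ.^ (n ∸ ν)

Expand : ℕ → (ℕ → ℤ) → ℤ
Expand n h = ∑ (λ ν → binom n ν * h ν) (suc n)

Expand-sub : ∀ n (h₁ h₂ : ℕ → ℤ) → Expand n (λ x → h₁ x - h₂ x) ≡ Expand n h₁ - Expand n h₂
Expand-sub n h₁ h₂ = trans (∑-cong (λ ν → distrib (binom n ν) (h₁ ν) (h₂ ν)) (suc n)) (∑-sub _ _ (suc n))
  where
  distrib : ∀ b x y → b * (x - y) ≡ b * x - b * y
  distrib = solve-∀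

Expand-step : ∀ n (h : ℕ → ℤ) → Expand (suc n) h ≡ Expand n (λ x → h (suc x)) - Expand n h
Expand-step n h = begin
    Expand (suc n) h
  ≡⟨ ∑-head _ (suc n) ⟩
    binom (suc n) 0 * h 0 + ∑ (λ ν → binom (suc n) (suc ν) * h (suc ν)) (suc n)
  ≡⟨ cong₂ (λ b S → b * h 0 + S) (binom-bottom n) (∑-cong pascal (suc n)) ⟩
    - binom n 0 * h 0 + ∑ (λ ν → binom n ν * h (suc ν) - binom n (suc ν) * h (suc ν)) (suc n)
  ≡⟨ cong (λ z → - binom n 0 * h 0 + z) (∑-sub _ _ (suc n)) ⟩
    - binom n 0 * h 0 + (Expand n (λ x → h (suc x)) - S)
  ≡⟨ regroup (binom n 0) (h 0) (Expand n (λ x → h (suc x))) S ⟩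
    Expand n (λ x → h (suc x)) - (binom n 0 * h 0 + S)
  ≡⟨ cong (λ z → Expand n (λ x → h (suc x)) - z) (sym (∑-head _ (suc n))) ⟩
    Expand n (λ x → h (suc x)) - (Expand n h + binom n (suc n) * h (suc n))
  ≡⟨ cong (λ b → Expand n (λ x → h (suc x)) - (Expand n h + b * h (suc n))) (binom-top n) ⟩
    Expand n (λ x → h (suc x)) - (Expand n h + 0ℤ * h (suc n))
  ≡⟨ cong (λ z → Expand n (λ x → h (suc x)) - z) (ℤP.+-identityʳ (Expand n h)) ⟩
    Expand n (λ x → h (suc x)) - Expand n h ∎
  where
  open ≡-Reasoning
  S = ∑ (λ ν → binom n (suc ν) * h (suc ν)) (suc n)
  pascal : ∀ ν → binom (suc n) (suc ν) * h (suc ν) ≡ binom n ν * h (suc ν) - binom n (suc ν) * h (suc ν)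
  pascal ν = trans (cong (_* h (suc ν)) (binom-pascal n ν)) (distrib (binom n ν) (binom n (suc ν)) (h (suc ν)))
    where
    distrib : ∀ b c x → (b - c) * x ≡ b * x - c * x
    distrib = solve-∀
  regroup : ∀ b x e t → - b * x + (e - t) ≡ e - (b * x + t)
  regroup = solve-∀

D-expand : ∀ n (h : ℕ → ℤ) → D n h 0 ≡ Expand n h
D-expand zero    h = unit (h 0)
  where
  unit : ∀ a → a ≡ 0ℤ + + 1 * a
  unit = solve-∀
D-expand (suc n) h = begin
    D n (Δ h) 0
  ≡⟨ D-expand n (Δ h) ⟩
    Expand n (Δ h)
  ≡⟨ Expand-sub n (λ x → h (suc x)) h ⟩
    Expand n (λ x → h (suc x)) - Expand n h
  ≡⟨ sym (Expand-step n h) ⟩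
    Expand (suc n) h ∎
  where open ≡-Reasoning

pow-suc : ∀ p k → + (p ℕ.^ suc k) ≡ + (p ℕ.^ k) * + p
pow-suc p k = trans (cong +_ (ℕP.*-comm p (p ℕ.^ k))) (ℤP.pos-* (p ℕ.^ k) p)

pow-∣ : ∀ p {a b} → a ≤ b → p ℕ.^ a ℕD.∣ p ℕ.^ b
pow-∣ p {a} {b} a≤b = ℕD.divides (p ℕ.^ (b ∸ a))
  (trans (cong (p ℕ.^_) (sym (ℕP.m∸n+n≡m a≤b))) (ℕP.^-distribˡ-+-* p (b ∸ a) a))

-- e(K) = 0 + 1 + ⋯ + (K-1); p^e(K) is a period of sequences of level K.
period-exp : ℕ → ℕ
period-exp zero    = 0
period-exp (suc K) = K ℕ.+ period-exp K

module Periodicity (p : ℕ) .{{_ : NonZero p}} where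

  -- The level-K form of the condition defining 𝒦_{p,2}: p^min(n,K) ∣ Δⁿg(N).
  DiffBound : ℕ → (ℕ → ℤ) → Set
  DiffBound K g = ∀ n N → + (p ℕ.^ (n ⊓ K)) ∣ D n g N

  -- The bound at N = 0 propagates to all N, since Δⁿg(N+1) = Δⁿg(N) + Δⁿ⁺¹g(N).
  diffBound-from-0 : ∀ K g → (∀ n → + (p ℕ.^ (n ⊓ K)) ∣ D n g 0) → DiffBound K g
  diffBound-from-0 K g at-0 n zero    = at-0 n
  diffBound-from-0 K g at-0 n (suc N) = subst (+ (p ℕ.^ (n ⊓ K)) ∣_) (sym next)
    (∣m∣n⇒∣m+n (diffBound-from-0 K g at-0 n N)
               (∣-trans (∣ᵤ⇒∣ (pow-∣ p (ℕP.⊓-monoˡ-≤ K (ℕP.n≤1+n n)))) (diffBound-from-0 K g at-0 (suc n) N)))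
    where
    add-back : ∀ a b → b ≡ a + (b - a)
    add-back = solve-∀
    next : D n g (suc N) ≡ D n g N + D (suc n) g N
    next = trans (add-back (D n g N) (D n g (suc N))) (cong (λ z → D n g N + z) (sym (D-step n g N)))

  divided-difference : ∀ K g → DiffBound (suc K) g →
    Σ (ℕ → ℤ) λ g' → (∀ x → Δ g x ≡ g' x * + p) × DiffBound K g'
  divided-difference K g bound = g' , Δg≡g'p , bound'
    where
    p∣Δg : ∀ x → + p ∣ Δ g x
    p∣Δg x = subst (λ q → + q ∣ Δ g x) (ℕP.*-identityʳ p) (bound 1 x)
    g' : ℕ → ℤ
    g' x = _∣_.quotient (p∣Δg x)
    Δg≡g'p : ∀ x → Δ g x ≡ g' x * + p
    Δg≡g'p x = _∣_.equality (p∣Δg x)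
    bound' : DiffBound K g'
    bound' n N = *-cancelʳ-∣ (+ p)
      (subst₂ _∣_ (pow-suc p (n ⊓ K)) (trans (D-cong n Δg≡g'p N) (D-scale n g' (+ p) N)) (bound (suc n) N))

  periodic : ∀ K g → DiffBound K g → ∀ a t → g (a ℕ.+ t ℕ.* p ℕ.^ period-exp K) ≡ g a [mod p ℕ.^ K ]
  periodic zero    g bound a t = mod (divides (g (a ℕ.+ t ℕ.* 1) - g a) (sym (ℤP.*-identityʳ _)))
  periodic (suc K) g bound a t =
    subst (λ i → g i ≡ g a [mod p ℕ.^ suc K ]) (sym index) (mod (mod-∣ growth negligible))
    where
    divided = divided-difference K g bound
    g' : ℕ → ℤ
    g' = proj₁ divided
    Δg≡g'p : ∀ x → Δ g x ≡ g' x * + p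
    Δg≡g'p = proj₁ (proj₂ divided)
    Q : ℕ
    Q = p ℕ.^ period-exp K
    H : ℕ → ℤ
    H b = g (b ℕ.+ Q) - g b
    -- H(b+1) - H(b) = p·(g'(b+Q) - g'(b)), and g' is Q-periodic modulo p^K
    H-step : ∀ b → H (suc b) ≡ H b [mod p ℕ.^ suc K ]
    H-step b = mod (subst₂ _∣_ (sym (pow-suc p K)) (sym H-diff) (*-monoˡ-∣ (+ p) (difference g'-periodic)))
      where
      g'-periodic : g' (b ℕ.+ Q) ≡ g' b [mod p ℕ.^ K ]
      g'-periodic = subst (λ i → g' (b ℕ.+ i) ≡ g' b [mod p ℕ.^ K ]) (ℕP.*-identityˡ Q)
                          (periodic K g' (proj₂ (proj₂ divided)) b 1)
      interchange : ∀ a b c d → (a - b) - (c - d) ≡ (a - c) - (b - d)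
      interchange = solve-∀
      factor : ∀ a b k → a * k - b * k ≡ (a - b) * k
      factor = solve-∀
      H-diff : H (suc b) - H b ≡ (g' (b ℕ.+ Q) - g' b) * + p
      H-diff = begin
          H (suc b) - H b
        ≡⟨ interchange (g (suc (b ℕ.+ Q))) (g (suc b)) (g (b ℕ.+ Q)) (g b) ⟩
          Δ g (b ℕ.+ Q) - Δ g b
        ≡⟨ cong₂ _-_ (Δg≡g'p (b ℕ.+ Q)) (Δg≡g'p b) ⟩
          g' (b ℕ.+ Q) * + p - g' b * + p
        ≡⟨ factor (g' (b ℕ.+ Q)) (g' b) (+ p) ⟩
          (g' (b ℕ.+ Q) - g' b) * + p ∎
        where open ≡-Reasoning
    -- g is constant modulo p since p ∣ Δg; in particular p ∣ H(0)
    p∣H0 : + p ∣ H 0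
    p∣H0 = difference (telescope g (λ x → mod (divides (g' x) (Δg≡g'p x))) Q)
    u : ℕ
    u = t ℕ.* p ℕ.^ K
    growth : g (a ℕ.+ u ℕ.* Q) - g a ≡ + u * H 0 [mod p ℕ.^ suc K ]
    growth = arith-progression g Q (H 0) (telescope H H-step) a u
    negligible : + (p ℕ.^ suc K) ∣ + u * H 0
    negligible = subst₂ _∣_ (sym (pow-suc p K))
      (trans (sym (ℤP.*-assoc (+ t) (+ (p ℕ.^ K)) (H 0))) (cong (_* H 0) (sym (ℤP.pos-* t (p ℕ.^ K)))))
      (∣n⇒∣m*n (+ t) (*-monoʳ-∣ (+ (p ℕ.^ K)) p∣H0))
    index : a ℕ.+ t ℕ.* p ℕ.^ period-exp (suc K) ≡ a ℕ.+ u ℕ.* Q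
    index = cong (a ℕ.+_) (trans (cong (t ℕ.*_) (ℕP.^-distribˡ-+-* p K (period-exp K)))
                                 (sym (ℕP.*-assoc t (p ℕ.^ K) Q)))

  periodic-≤ : ∀ K g → DiffBound K g → ∀ {a b} → a ≤ b →
    + b ≡ + a [mod p ℕ.^ period-exp K ] → g b ≡ g a [mod p ℕ.^ K ]
  periodic-≤ K g bound {a} {b} a≤b (mod d) =
    subst (λ i → g i ≡ g a [mod p ℕ.^ K ]) index (periodic K g bound a t)
    where
    P∣b∸a : p ℕ.^ period-exp K ℕD.∣ b ∸ a
    P∣b∸a = ∣⇒∣ᵤ (subst (+ (p ℕ.^ period-exp K) ∣_) (trans (ℤP.[+m]-[+n]≡m⊖n b a) (ℤP.⊖-≥ a≤b)) d)
    t : ℕ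
    t = ℕD._∣_.quotient P∣b∸a
    index : a ℕ.+ t ℕ.* p ℕ.^ period-exp K ≡ b
    index = trans (cong (a ℕ.+_) (sym (ℕD._∣_.equality P∣b∸a))) (ℕP.m+[n∸m]≡n a≤b)

  periodic-mod : ∀ K g → DiffBound K g → ∀ a b →
    + a ≡ + b [mod p ℕ.^ period-exp K ] → g a ≡ g b [mod p ℕ.^ K ]
  periodic-mod K g bound a b a≡b with ℕP.≤-total a b
  ... | inj₁ a≤b = mod-sym (periodic-≤ K g bound a≤b (mod-sym a≡b))
  ... | inj₂ b≤a = periodic-≤ K g bound b≤a a≡b

module _ {p : ℕ} where

  approx-sumBelow : ∀ (h : ℕ → ℤₚ p) m k → approx (sumBelow h m) k ≡ ∑ (λ ν → approx (h ν) k) m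
  approx-sumBelow h zero    k = refl
  approx-sumBelow h (suc m) k = cong (_+ approx (h m) k) (approx-sumBelow h m k)

  approx-finDiff : ∀ (g : ℕ → ℤₚ p) n k → approx (finDiff g n) k ≡ D n (λ ν → approx (g ν) k) 0
  approx-finDiff g n k = trans (approx-sumBelow _ (suc n) k) (sym (D-expand n _))

module Truncation (p : ℕ) .{{_ : NonZero p}} where

  approx-refine : ∀ (x : ℤₚ p) {i j} → i ≤ j → approx x j ≡ approx x i [mod p ℕ.^ i ]
  approx-refine x {i} {j} i≤j =
    subst (λ k → approx x k ≡ approx x i [mod p ℕ.^ i ]) (ℕP.m∸n+n≡m i≤j) (chain (j ∸ i))
    where
    chain : ∀ d → approx x (d ℕ.+ i) ≡ approx x i [mod p ℕ.^ i ]
    chain zero    = mod-reflexive refl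
    chain (suc d) = mod-trans (mod-weaken (pow-∣ p (ℕP.m≤n+m i d)) (mod (coh x (d ℕ.+ i)))) (chain d)

  trunc : ℕ → ℤₚ p → ℕ
  trunc j x = _%ℕ_ (approx x j) (p ℕ.^ j) {{ℕP.m^n≢0 p j}}

  trunc-≡ : ∀ x {i j} → i ≤ j → approx x i ≡ + trunc j x [mod p ℕ.^ i ]
  trunc-≡ x {i} {j} i≤j = mod-trans (mod-sym (approx-refine x i≤j))
    (mod-weaken (pow-∣ p i≤j) (%ℕ-≡ (approx x j) (p ℕ.^ j) {{ℕP.m^n≢0 p j}}))

  trunc-refine : ∀ x {i j} → i ≤ j → + trunc j x ≡ + trunc i x [mod p ℕ.^ i ]
  trunc-refine x i≤j = mod-trans (mod-sym (trunc-≡ x i≤j)) (trunc-≡ x ℕP.≤-refl)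

module Extension (p : ℕ) .{{_ : NonZero p}} (f : ℕ → ℤₚ p)
                 (hyp : ∀ n → finDiff f n ∈p^ n ℤₚ) where
  open Periodicity p
  open Truncation p

  level : ℕ → ℕ → ℤ
  level K ν = approx (f ν) K

  -- Each level satisfies the difference bound: p^min(n,K) ∣ Δⁿ level_K(N).  At N = 0
  -- this is the hypothesis p^n ∣ Δⁿf(0) read at the common precision p^min(n,K).
  level-diffBound : ∀ K → DiffBound K (level K)
  level-diffBound K = diffBound-from-0 K (level K) at-0
    where
    at-0 : ∀ n → + (p ℕ.^ (n ⊓ K)) ∣ D n (level K) 0
    at-0 n = mod-∣ (D-mod n close 0)
      (∣-trans (∣ᵤ⇒∣ (pow-∣ p (ℕP.m⊓n≤m n K))) (subst (+ (p ℕ.^ n) ∣_) (approx-finDiff f n n) (hyp n)))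
      where
      close : ∀ ν → level K ν ≡ level n ν [mod p ℕ.^ (n ⊓ K) ]
      close ν = mod-trans (approx-refine (f ν) (ℕP.m⊓n≤n n K)) (mod-sym (approx-refine (f ν) (ℕP.m⊓n≤m n K)))

  level-periodic : ∀ K a b → + a ≡ + b [mod p ℕ.^ period-exp K ] → level K a ≡ level K b [mod p ℕ.^ K ]
  level-periodic K = periodic-mod K (level K) (level-diffBound K)

  F-approx : ℤₚ p → ℕ → ℤ
  F-approx x k = level k (trunc (period-exp k) x)

  F-coh : ∀ x k → F-approx x (suc k) ≡ F-approx x k [mod p ℕ.^ k ]
  F-coh x k = mod-trans (mod (coh (f (trunc (period-exp (suc k)) x)) k))
    (level-periodic k _ _ (trunc-refine x (ℕP.m≤n+m (period-exp k) k)))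

  F : ℤₚ p → ℤₚ p
  F x = mkℤₚ (F-approx x) (λ k → difference (F-coh x k))

  -- F(x) mod p^k only depends on x mod p^e(k).
  F-continuous : Continuous F
  F-continuous x k = period-exp k , λ y x≡y → difference (level-periodic k _ _ (begin
      + trunc e x  ≈⟨ trunc-≡ x ℕP.≤-refl ⟨
      approx x e   ≈⟨ mod x≡y ⟩
      approx y e   ≈⟨ trunc-≡ y ℕP.≤-refl ⟩
      + trunc e y  ∎))
    where
    e = period-exp k
    open ModReasoning (p ℕ.^ e)

  -- For x = n ∈ ℕ₀ the truncation of n is congruent to n modulo p^e(k).
  F-extends : Extends F f
  F-extends n k = difference (level-periodic k _ _ (mod-sym (trunc-≡ (ι n) (ℕP.≤-refl {period-exp k}))))

  -- Δⁿ F(s) at precision p^n is Δⁿ level_n at the truncation of s, divisible by p^n.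
  F-in-𝒦₂ : 𝒦₂ F
  F-in-𝒦₂ s n = subst (+ (p ℕ.^ n) ∣_) (sym (approx-finDiff (λ ν → F (s +ₚ ι ν)) n n)) (mod-∣ shifted bound)
    where
    e = period-exp n
    T = trunc e s
    -- s + ν is represented at precision p^e(n) by the natural number T + ν
    shift : ∀ ν → F-approx (s +ₚ ι ν) n ≡ level n (T ℕ.+ ν) [mod p ℕ.^ n ]
    shift ν = level-periodic n _ _ (mod-trans (mod-sym (trunc-≡ (s +ₚ ι ν) ℕP.≤-refl)) (mod-+ʳ (+ ν) (trunc-≡ s ℕP.≤-refl)))
    shifted : D n (λ ν → F-approx (s +ₚ ι ν) n) 0 ≡ D n (level n) T [mod p ℕ.^ n ]
    shifted = mod-trans (D-mod n shift 0) (mod-reflexive (D-translate n (level n) T))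
    bound : + (p ℕ.^ n) ∣ D n (level n) T
    bound = subst (λ i → + (p ℕ.^ i) ∣ D n (level n) T) (ℕP.⊓-idem n) (level-diffBound n n T)

  -- ℕ₀ is dense: G(x) ≈ G(r) = f(r) ≈ F(x) for r ∈ ℕ₀ close enough to x.
  F-unique : ∀ G → Continuous G → Extends G f → ∀ x → G x ≈ₚ F x
  F-unique G G-cont G-ext x k = difference (begin
      approx (G x) k      ≈⟨ mod (proj₂ (G-cont x k) (ι r) (difference (trunc-≡ x (ℕP.m≤m+n m e)))) ⟩
      approx (G (ι r)) k  ≈⟨ mod (G-ext r k) ⟩
      level k r           ≈⟨ level-periodic k r (trunc e x) (trunc-refine x (ℕP.m≤n+m e m)) ⟩
      F-approx x k        ∎)
    where
    open ModReasoning (p ℕ.^ k)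
    e = period-exp k
    m = proj₁ (G-cont x k)
    r = trunc (m ℕ.+ e) x

proposition7p2 : (p : ℕ) → Prime p → (f : ℕ → ℤₚ p) →
    (∀ (n : ℕ) → finDiff f n ∈p^ n ℤₚ) →
    Σ (ℤₚ p → ℤₚ p) (λ F →
      (Continuous F × Extends F f × 𝒦₂ F) ×
      (∀ (G : ℤₚ p → ℤₚ p) → Continuous G → Extends G f →
        ∀ (x : ℤₚ p) → G x ≈ₚ F x))
proposition7p2 p p-prime f hyp = F , (F-continuous , F-extends , F-in-𝒦₂) , F-unique
  where open Extension p {{prime⇒nonZero p-prime}} f hyp
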